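{- In the setting of the context, let $x\in\mathbb{R}^{n^2}$ be nonzero and let $y,z\in\mathbb{R}^k$ be nonzero vectors with $J_ky=J_kz=0$. Then $x\otimes y\otimes z$ is an eigenvector of $A^{(k)}$ with eigenvalue $-1$.
   Context: $n,k\ge1$; $T$ is a partition of the cells of an $n\times n$ grid into $n$ blocks of $n$ cells each, cells numbered $1,\dots,n^2$. $(L_B)_{ij}=1$ iff $i\ne j$ and cells $i,j$ share a block; $(L_H)_{ij}=1$ iff cells $i,j$ share a row but not a block; $(L_V)_{ij}=1$ iff cells $i,j$ share a column but not a block; all other entries $0$. $J_r$ is the $r\times r$ all-ones matrix, $I_r$ the identity, $\otimes$ the Kronecker product. $A^{(k)}$ denotes the matrix $L_B\otimes J_{k^2}+L_H\otimes(I_k\otimes J_k)+L_V\otimes(J_k\otimes I_k)+I_{n^2}\otimes(J_{k^2}-I_{k^2})$, the adjacency matrix of the $k$-fold blow up of the puzzle with cell in relative row $a$, column $b$ of the square of original cell $i$ numbered $(i-1)k^2+(a-1)k+b$. -}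

module Defs where

open import Level using (Level; _⊔_)
open import Data.Nat using (ℕ)
open import Data.Fin using (Fin; zero; suc)
open import Data.Fin.Properties using () renaming (_≟_ to _≟F_)
open import Data.Product using (_×_; _,_; Σ; ∃)
open import Data.Bool using (Bool; true; false; _∧_; not)
open import Relation.Nullary.Decidable using (⌊_⌋)
open import Relation.Binary.PropositionalEquality using (_≡_)
open import Function.Bundles using (_↔_)
open import Algebra.Bundles using (CommutativeRing)

Cell : ℕ → Set
Cell n = Fin n × Fin n

row col : ∀ {n} → Cell n → Fin n
row (r , _) = r
col (_ , c) = c

eqF : ∀ {n} → Fin n → Fin n → Bool
eqF i j = ⌊ i ≟F j ⌋

eqC : ∀ {n} → Cell n → Cell n → Bool
eqC (r , c) (r' , c') = eqF r r' ∧ eqF c c'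

record Partition (n : ℕ) : Set where
  field
    block    : Cell n → Fin n
    blockSize : ∀ (β : Fin n) → Fin n ↔ Σ (Cell n) (λ c → block c ≡ β)
open Partition public

module _ {c ℓ} (R : CommutativeRing c ℓ) where
  open CommutativeRing R hiding (zero)

  -- R is a field (the paper works over ℝ).
  IsField : Set (c ⊔ ℓ)
  IsField = (1# ≉ 0#) × (∀ x → x ≉ 0# → ∃ λ y → x * y ≈ 1#)

  Mat : Set → Set → Set c
  Mat I J = I → J → Carrier

  Vect : Set → Set c
  Vect I = I → Carrier

  ind : Bool → Carrier
  ind true  = 1#
  ind false = 0#

  ΣF : (m : ℕ) → (Fin m → Carrier) → Carrier
  ΣF 0 f = 0#
  ΣF (ℕ.suc m) f = f zero + ΣF m (λ i → f (suc i))

  ΣKK : (k : ℕ) → (Fin k × Fin k → Carrier) → Carrier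
  ΣKK k f = ΣF k (λ a → ΣF k (λ b → f (a , b)))

  ΣC : (n : ℕ) → (Cell n → Carrier) → Carrier
  ΣC n f = ΣKK n f

  -- index of the blow up: (original cell i , (relative row a , relative column b)),
  -- ordered lexicographically, i.e. position (i-1)k²+(a-1)k+b.
  Blow : ℕ → ℕ → Set
  Blow n k = Cell n × (Fin k × Fin k)

  ΣB : (n k : ℕ) → (Blow n k → Carrier) → Carrier
  ΣB n k f = ΣC n (λ i → ΣKK k (λ ab → f (i , ab)))

  apply : ∀ {I J : Set} → ((J → Carrier) → Carrier) → Mat I J → Vect J → Vect I
  apply sum M v i = sum (λ j → M i j * v j)

  _⊗M_ : ∀ {I I' J J'} → Mat I I' → Mat J J' → Mat (I × J) (I' × J')
  (M ⊗M N) (i , j) (i' , j') = M i i' * N j j'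

  _⊗V_ : ∀ {I J} → Vect I → Vect J → Vect (I × J)
  (x ⊗V y) (i , j) = x i * y j

  _+M_ : ∀ {I J} → Mat I J → Mat I J → Mat I J
  (M +M N) i j = M i j + N i j

  _-M_ : ∀ {I J} → Mat I J → Mat I J → Mat I J
  (M -M N) i j = M i j - N i j

  Jm : ∀ (I : Set) → Mat I I
  Jm I _ _ = 1#

  Ik : (k : ℕ) → Mat (Fin k) (Fin k)
  Ik k a a' = ind (eqF a a')

  Ikk : (k : ℕ) → Mat (Fin k × Fin k) (Fin k × Fin k)
  Ikk k p q = ind (eqC p q)

  In2 : (n : ℕ) → Mat (Cell n) (Cell n)
  In2 n p q = ind (eqC p q)

  module _ {n : ℕ} (T : Partition n) where
    sameBlock : Cell n → Cell n → Bool
    sameBlock i j = eqF (block T i) (block T j)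

    L-B L-H L-V : Mat (Cell n) (Cell n)
    L-B i j = ind (not (eqC i j) ∧ sameBlock i j)
    L-H i j = ind (eqF (row i) (row j) ∧ not (sameBlock i j))
    L-V i j = ind (eqF (col i) (col j) ∧ not (sameBlock i j))

  A : (n k : ℕ) → Partition n → Mat (Blow n k) (Blow n k)
  A n k T =   (L-B T ⊗M Jm (Fin k × Fin k))
           +M ((L-H T ⊗M (Ik k ⊗M Jm (Fin k)))
           +M ((L-V T ⊗M (Jm (Fin k) ⊗M Ik k))
           +M (In2 n ⊗M (Jm (Fin k × Fin k) -M Ikk k))))

  NonZeroV : ∀ {I} → Vect I → Set (ℓ)
  NonZeroV {I} v = ∃ λ (i : I) → v i ≉ 0#

  IsEigenvector : ∀ {I : Set} → ((I → Carrier) → Carrier) → Mat I I → Vect I → Carrier → Set ℓ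
  IsEigenvector {I} sum M v μ = NonZeroV v × (∀ (i : I) → apply sum M v i ≈ μ * v i)

  KilledByJ : (k : ℕ) → Vect (Fin k) → Set ℓ
  KilledByJ k y = ∀ a → apply (ΣF k) (Jm (Fin k)) y a ≈ 0#

  minusOne : Carrier
  minusOne = - 1#

module Submission where

-- A⁽ᵏ⁾ is a sum of four Kronecker products M ⊗ N with M acting on the
-- original cells and N on the k × k square of a blown up cell.  By the
-- mixed product rule (M ⊗ N)(u ⊗ w) = (M u) ⊗ (N w), it suffices to see
-- how each N acts on y ⊗ z, where J y = J z = 0:
--   J_{k²} = J_k ⊗ J_k   gives (J y) ⊗ (J z)      = 0,
--   I_k ⊗ J_k            gives y ⊗ (J z)          = 0,
--   J_k ⊗ I_k            gives (J y) ⊗ z          = 0,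
--   J_{k²} − I_{k²}      gives 0 − y ⊗ z          = −(y ⊗ z),
-- while the last factor I_{n²} fixes x.  Hence A⁽ᵏ⁾(x ⊗ y ⊗ z) = −(x ⊗ y ⊗ z),
-- and x ⊗ y ⊗ z is nonzero since a product of nonzero field elements is nonzero.

open import Defs
open import Level using (_⊔_)
open import Data.Nat using (ℕ; _≥_)
open import Data.Fin using (Fin; zero; suc)
open import Data.Fin.Properties using (_≟_; suc-injective)
open import Data.Product using (_×_; _,_)
open import Data.Bool using (true; false)
open import Relation.Nullary using (Dec; yes; no; ¬_)
open import Relation.Nullary.Decidable using (dec-true; dec-false; isYes≗does)
open import Relation.Binary.PropositionalEquality as P using (_≡_)
open import Algebra.Bundles using (CommutativeRing)
import Relation.Binary.Reasoning.Setoid as SetoidReasoning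
import Algebra.Properties.Ring as RingProperties
import Algebra.Properties.CommutativeSemigroup as CommutativeSemigroupProperties

eqF-true : ∀ {m} {b b' : Fin m} → b ≡ b' → eqF b b' ≡ true
eqF-true {b = b} {b'} e = P.trans (isYes≗does (b ≟ b')) (dec-true (b ≟ b') e)

eqF-false : ∀ {m} {b b' : Fin m} → ¬ b ≡ b' → eqF b b' ≡ false
eqF-false {b = b} {b'} ne = P.trans (isYes≗does (b ≟ b')) (dec-false (b ≟ b') ne)

eqF-suc : ∀ {m} (a a' : Fin m) → eqF {ℕ.suc m} (suc a) (suc a') ≡ eqF a a'
eqF-suc a a' = by-cases (a ≟ a')
  where
  by-cases : Dec (a ≡ a') → eqF (suc a) (suc a') ≡ eqF a a'
  by-cases (yes a≡a') = P.trans (eqF-true (P.cong suc a≡a')) (P.sym (eqF-true a≡a'))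
  by-cases (no a≢a')  = P.trans (eqF-false (λ e → a≢a' (suc-injective e))) (P.sym (eqF-false a≢a'))

module _ {c ℓ} (R : CommutativeRing c ℓ) where
  open CommutativeRing R hiding (zero)
  open SetoidReasoning setoid
  open RingProperties ring using (-1*x≈-x; -‿distribˡ-*)
  open CommutativeSemigroupProperties *-commutativeSemigroup using () renaming (interchange to *-interchange)
  open CommutativeSemigroupProperties +-commutativeSemigroup using () renaming (interchange to +-interchange)

  record Summation (I : Set) : Set (c ⊔ ℓ) where
    field
      sum     : (I → Carrier) → Carrier
      sum-cong : ∀ {f g} → (∀ i → f i ≈ g i) → sum f ≈ sum g
      sum-+   : ∀ f g → sum (λ i → f i + g i) ≈ sum f + sum g
      sum-*ˡ  : ∀ a f → sum (λ i → a * f i) ≈ a * sum f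

    sum-*ʳ : ∀ a f → sum (λ i → f i * a) ≈ sum f * a
    sum-*ʳ a f = begin
      sum (λ i → f i * a) ≈⟨ sum-cong (λ i → *-comm (f i) a) ⟩
      sum (λ i → a * f i) ≈⟨ sum-*ˡ a f ⟩
      a * sum f           ≈⟨ *-comm a (sum f) ⟩
      sum f * a           ∎
  open Summation

  ΣF-cong : ∀ m {f g : Fin m → Carrier} → (∀ i → f i ≈ g i) → ΣF R m f ≈ ΣF R m g
  ΣF-cong ℕ.zero e = refl
  ΣF-cong (ℕ.suc m) e = +-cong (e zero) (ΣF-cong m (λ i → e (suc i)))

  ΣF-+ : ∀ m (f g : Fin m → Carrier) → ΣF R m (λ i → f i + g i) ≈ ΣF R m f + ΣF R m g
  ΣF-+ ℕ.zero f g = sym (+-identityˡ 0#)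
  ΣF-+ (ℕ.suc m) f g = begin
    (f zero + g zero) + ΣF R m (λ i → f (suc i) + g (suc i))
      ≈⟨ +-cong refl (ΣF-+ m (λ i → f (suc i)) (λ i → g (suc i))) ⟩
    (f zero + g zero) + (ΣF R m (λ i → f (suc i)) + ΣF R m (λ i → g (suc i)))
      ≈⟨ +-interchange (f zero) (g zero) _ _ ⟩
    (f zero + ΣF R m (λ i → f (suc i))) + (g zero + ΣF R m (λ i → g (suc i))) ∎

  ΣF-*ˡ : ∀ m a (f : Fin m → Carrier) → ΣF R m (λ i → a * f i) ≈ a * ΣF R m f
  ΣF-*ˡ ℕ.zero a f = sym (zeroʳ a)
  ΣF-*ˡ (ℕ.suc m) a f = trans (+-cong refl (ΣF-*ˡ m a (λ i → f (suc i)))) (sym (distribˡ a _ _))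

  finSum : (m : ℕ) → Summation (Fin m)
  finSum m = record { sum = ΣF R m ; sum-cong = ΣF-cong m ; sum-+ = ΣF-+ m ; sum-*ˡ = ΣF-*ˡ m }

  _⊗S_ : ∀ {I J} → Summation I → Summation J → Summation (I × J)
  S ⊗S T = record
    { sum      = λ f → sum S (λ i → sum T (λ j → f (i , j)))
    ; sum-cong = λ e → sum-cong S (λ i → sum-cong T (λ j → e (i , j)))
    ; sum-+    = λ f g → trans (sum-cong S (λ i → sum-+ T _ _)) (sum-+ S _ _)
    ; sum-*ˡ   = λ a f → trans (sum-cong S (λ i → sum-*ˡ T a _)) (sum-*ˡ S a _)
    }

  sum-⊗ : ∀ {I J} (S : Summation I) (T : Summation J) (u : Vect R I) (w : Vect R J) →
          sum (S ⊗S T) (_⊗V_ R u w) ≈ sum S u * sum T w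
  sum-⊗ S T u w = begin
    sum S (λ i → sum T (λ j → u i * w j)) ≈⟨ sum-cong S (λ i → sum-*ˡ T (u i) w) ⟩
    sum S (λ i → u i * sum T w)           ≈⟨ sum-*ʳ S (sum T w) u ⟩
    sum S u * sum T w                     ∎

  _≈M_ : ∀ {I J} → Mat R I J → Mat R I J → Set ℓ
  M ≈M N = ∀ i j → M i j ≈ N i j

  module _ {I J : Set} (S : Summation J) where

    apply-cong : ∀ {M N : Mat R I J} → M ≈M N → ∀ v i → apply R (sum S) M v i ≈ apply R (sum S) N v i
    apply-cong M≈N v i = sum-cong S (λ j → *-cong (M≈N i j) refl)

    apply-+M : ∀ (M N : Mat R I J) v i →
               apply R (sum S) (_+M_ R M N) v i ≈ apply R (sum S) M v i + apply R (sum S) N v i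
    apply-+M M N v i = trans (sum-cong S (λ j → distribʳ (v j) (M i j) (N i j))) (sum-+ S _ _)

    apply--M : ∀ (M N : Mat R I J) v i →
               apply R (sum S) (_-M_ R M N) v i ≈ apply R (sum S) M v i - apply R (sum S) N v i
    apply--M M N v i = begin
      sum S (λ j → (M i j - N i j) * v j)
        ≈⟨ sum-cong S (λ j → negated-term j) ⟩
      sum S (λ j → M i j * v j + - 1# * (N i j * v j))
        ≈⟨ sum-+ S _ _ ⟩
      sum S (λ j → M i j * v j) + sum S (λ j → - 1# * (N i j * v j))
        ≈⟨ +-cong refl (trans (sum-*ˡ S (- 1#) _) (-1*x≈-x _)) ⟩
      sum S (λ j → M i j * v j) - sum S (λ j → N i j * v j) ∎
      where
      negated-term : ∀ j → (M i j - N i j) * v j ≈ M i j * v j + - 1# * (N i j * v j)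
      negated-term j = trans (distribʳ (v j) (M i j) (- N i j))
        (+-cong refl (trans (sym (-‿distribˡ-* (N i j) (v j))) (sym (-1*x≈-x _))))

  mixed-product : ∀ {I I' J J'} (S : Summation I') (T : Summation J')
                  (M : Mat R I I') (N : Mat R J J') (u : Vect R I') (w : Vect R J') i j →
                  apply R (sum (S ⊗S T)) (_⊗M_ R M N) (_⊗V_ R u w) (i , j)
                  ≈ apply R (sum S) M u i * apply R (sum T) N w j
  mixed-product S T M N u w i j = begin
    sum (S ⊗S T) (λ { (i' , j') → (M i i' * N j j') * (u i' * w j') })
      ≈⟨ sum-cong (S ⊗S T) (λ { (i' , j') → *-interchange (M i i') (N j j') (u i') (w j') }) ⟩
    sum (S ⊗S T) (_⊗V_ R (λ i' → M i i' * u i') (λ j' → N j j' * w j'))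
      ≈⟨ sum-⊗ S T _ _ ⟩
    apply R (sum S) M u i * apply R (sum T) N w j ∎

  block-vanishes : ∀ {I I' J J'} (S : Summation I') (T : Summation J')
                   (M : Mat R I I') (N : Mat R J J') (u : Vect R I') (w : Vect R J') i j →
                   apply R (sum T) N w j ≈ 0# →
                   apply R (sum (S ⊗S T)) (_⊗M_ R M N) (_⊗V_ R u w) (i , j) ≈ 0#
  block-vanishes S T M N u w i j Nw≈0 =
    trans (mixed-product S T M N u w i j) (trans (*-cong refl Nw≈0) (zeroʳ _))

  IsIdentity : ∀ {I} → Summation I → Mat R I I → Set (c ⊔ ℓ)
  IsIdentity {I} S M = ∀ (v : Vect R I) i → apply R (sum S) M v i ≈ v i

  Ik-identity : ∀ m → IsIdentity (finSum m) (Ik R m)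
  Ik-identity (ℕ.suc m) v zero = begin
    1# * v zero + ΣF R m (λ i → 0# * v (suc i))
      ≈⟨ +-cong (*-identityˡ _) (trans (sum-*ˡ (finSum m) 0# _) (zeroˡ _)) ⟩
    v zero + 0# ≈⟨ +-identityʳ _ ⟩
    v zero      ∎
  Ik-identity (ℕ.suc m) v (suc a) = begin
    0# * v zero + ΣF R m (λ i → ind R (eqF {ℕ.suc m} (suc a) (suc i)) * v (suc i))
      ≈⟨ +-cong (zeroˡ _) (sum-cong (finSum m) (λ i → *-cong (reflexive (P.cong (ind R) (eqF-suc a i))) refl)) ⟩
    0# + ΣF R m (λ i → ind R (eqF a i) * v (suc i))
      ≈⟨ +-cong refl (Ik-identity m (λ i → v (suc i)) a) ⟩
    0# + v (suc a) ≈⟨ +-identityˡ _ ⟩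
    v (suc a)      ∎

  ⊗-identity : ∀ {I J} (S : Summation I) (T : Summation J) {M : Mat R I I} {N : Mat R J J} →
               IsIdentity S M → IsIdentity T N → IsIdentity (S ⊗S T) (_⊗M_ R M N)
  ⊗-identity S T {M} {N} idM idN v (i , j) = begin
    sum S (λ i' → sum T (λ j' → (M i i' * N j j') * v (i' , j')))
      ≈⟨ sum-cong S (λ i' → trans (sum-cong T (λ j' → *-assoc _ _ _)) (sum-*ˡ T _ _)) ⟩
    sum S (λ i' → M i i' * sum T (λ j' → N j j' * v (i' , j')))
      ≈⟨ sum-cong S (λ i' → *-cong refl (idN (λ j' → v (i' , j')) j)) ⟩
    sum S (λ i' → M i i' * v (i' , j))
      ≈⟨ idM (λ i' → v (i' , j)) i ⟩
    v (i , j) ∎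

  pair-identity : ∀ m → IsIdentity (finSum m ⊗S finSum m) (λ p q → ind R (eqC p q))
  pair-identity m v p = trans (apply-cong (finSum m ⊗S finSum m) ind-∧ v p)
                              (⊗-identity (finSum m) (finSum m) (Ik-identity m) (Ik-identity m) v p)
    where
    ind-∧ : (λ p q → ind R (eqC p q)) ≈M _⊗M_ R (Ik R m) (Ik R m)
    ind-∧ (a , b) (a' , b') with eqF a a'
    ... | true  = sym (*-identityˡ _)
    ... | false = sym (zeroˡ _)

  nonzero-* : IsField R → ∀ {u v} → u ≉ 0# → v ≉ 0# → u * v ≉ 0#
  nonzero-* (_ , inverse) {u} {v} u≉0 v≉0 uv≈0 with inverse u u≉0
  ... | u⁻¹ , uu⁻¹≈1 = v≉0 (begin
    v               ≈⟨ sym (*-identityˡ v) ⟩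
    1# * v          ≈⟨ *-cong (sym uu⁻¹≈1) refl ⟩
    (u * u⁻¹) * v   ≈⟨ *-cong (*-comm u u⁻¹) refl ⟩
    (u⁻¹ * u) * v   ≈⟨ *-assoc u⁻¹ u v ⟩
    u⁻¹ * (u * v)   ≈⟨ *-cong refl uv≈0 ⟩
    u⁻¹ * 0#        ≈⟨ zeroʳ u⁻¹ ⟩
    0#              ∎)

  module BlowUp (n k : ℕ) (T : Partition n) (x : Vect R (Cell n)) (y z : Vect R (Fin k))
                (Jy≈0 : KilledByJ R k y) (Jz≈0 : KilledByJ R k z) where

    Sk : Summation (Fin k × Fin k)
    Sk = finSum k ⊗S finSum k

    Sn : Summation (Cell n)
    Sn = finSum n ⊗S finSum n

    yz : Vect R (Fin k × Fin k)
    yz = _⊗V_ R y z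

    Jk : Mat R (Fin k) (Fin k)
    Jk = Jm R (Fin k)

    Jkk : Mat R (Fin k × Fin k) (Fin k × Fin k)
    Jkk = Jm R (Fin k × Fin k)

    rowFactor colFactor diagFactor : Mat R (Fin k × Fin k) (Fin k × Fin k)
    rowFactor  = _⊗M_ R (Ik R k) Jk
    colFactor  = _⊗M_ R Jk (Ik R k)
    diagFactor = _-M_ R Jkk (Ikk R k)

    Jkk-kills : ∀ q → apply R (sum Sk) Jkk yz q ≈ 0#
    Jkk-kills (a , b) = begin
      apply R (sum Sk) Jkk yz (a , b)
        ≈⟨ apply-cong Sk (λ _ _ → sym (*-identityˡ 1#)) yz (a , b) ⟩
      apply R (sum Sk) (_⊗M_ R Jk Jk) yz (a , b)
        ≈⟨ mixed-product (finSum k) (finSum k) Jk Jk y z a b ⟩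
      apply R (ΣF R k) Jk y a * apply R (ΣF R k) Jk z b
        ≈⟨ trans (*-cong (Jy≈0 a) refl) (zeroˡ _) ⟩
      0# ∎

    row-kills : ∀ q → apply R (sum Sk) rowFactor yz q ≈ 0#
    row-kills (a , b) = block-vanishes (finSum k) (finSum k) (Ik R k) Jk y z a b (Jz≈0 b)

    col-kills : ∀ q → apply R (sum Sk) colFactor yz q ≈ 0#
    col-kills (a , b) = trans (mixed-product (finSum k) (finSum k) Jk (Ik R k) y z a b)
                              (trans (*-cong (Jy≈0 a) refl) (zeroˡ _))

    diag-negates : ∀ q → apply R (sum Sk) diagFactor yz q ≈ - 1# * yz q
    diag-negates q = begin
      apply R (sum Sk) diagFactor yz q
        ≈⟨ apply--M Sk Jkk (Ikk R k) yz q ⟩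
      apply R (sum Sk) Jkk yz q - apply R (sum Sk) (Ikk R k) yz q
        ≈⟨ +-cong (Jkk-kills q) (-‿cong (pair-identity k yz q)) ⟩
      0# - yz q   ≈⟨ +-identityˡ _ ⟩
      - yz q      ≈⟨ sym (-1*x≈-x _) ⟩
      - 1# * yz q ∎

    eigen : ∀ p → apply R (ΣB R n k) (A R n k T) (_⊗V_ R x yz) p ≈ minusOne R * _⊗V_ R x yz p
    eigen p@(i , q) = begin
      apply R (sum SB) (A R n k T) v p
        ≈⟨ trans (apply-+M SB blockB (_+M_ R blockH (_+M_ R blockV blockD)) v p) (+-cong refl
           (trans (apply-+M SB blockH (_+M_ R blockV blockD) v p) (+-cong refl (apply-+M SB blockV blockD v p)))) ⟩
      apply R (sum SB) blockB v p + (apply R (sum SB) blockH v p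
        + (apply R (sum SB) blockV v p + apply R (sum SB) blockD v p))
        ≈⟨ +-cong (block-vanishes Sn Sk (L-B R T) Jkk x yz i q (Jkk-kills q))
          (+-cong (block-vanishes Sn Sk (L-H R T) rowFactor x yz i q (row-kills q))
          (+-cong (block-vanishes Sn Sk (L-V R T) colFactor x yz i q (col-kills q))
                  (mixed-product Sn Sk (In2 R n) diagFactor x yz i q))) ⟩
      0# + (0# + (0# + apply R (sum Sn) (In2 R n) x i * apply R (sum Sk) diagFactor yz q))
        ≈⟨ trans (+-identityˡ _) (trans (+-identityˡ _) (+-identityˡ _)) ⟩
      apply R (sum Sn) (In2 R n) x i * apply R (sum Sk) diagFactor yz q
        ≈⟨ *-cong (pair-identity n x i) (diag-negates q) ⟩
      x i * (- 1# * yz q)  ≈⟨ sym (*-assoc _ _ _) ⟩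
      (x i * - 1#) * yz q  ≈⟨ *-cong (*-comm _ _) refl ⟩
      (- 1# * x i) * yz q  ≈⟨ *-assoc _ _ _ ⟩
      - 1# * (x i * yz q)  ∎
      where
      SB : Summation (Cell n × (Fin k × Fin k))
      SB = Sn ⊗S Sk

      v : Vect R (Cell n × (Fin k × Fin k))
      v = _⊗V_ R x yz

      blockB blockH blockV blockD : Mat R (Cell n × (Fin k × Fin k)) (Cell n × (Fin k × Fin k))
      blockB = _⊗M_ R (L-B R T) Jkk
      blockH = _⊗M_ R (L-H R T) rowFactor
      blockV = _⊗M_ R (L-V R T) colFactor
      blockD = _⊗M_ R (In2 R n) diagFactor

lemma4 : ∀ {c ℓ} (R : CommutativeRing c ℓ) → IsField R →
         (n k : ℕ) → n ≥ 1 → k ≥ 1 → (T : Partition n) →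
         (x : Vect R (Cell n)) (y z : Vect R (Fin k)) →
         NonZeroV R x → NonZeroV R y → NonZeroV R z →
         KilledByJ R k y → KilledByJ R k z →
         IsEigenvector R (ΣB R n k) (A R n k T) (_⊗V_ R x (_⊗V_ R y z)) (minusOne R)
lemma4 R isField n k _ _ T x y z (i , xi≉0) (a , ya≉0) (b , zb≉0) Jy≈0 Jz≈0 =
  nonzero , BlowUp.eigen R n k T x y z Jy≈0 Jz≈0
  where
  nonzero : NonZeroV R (_⊗V_ R x (_⊗V_ R y z))
  nonzero = (i , (a , b)) , nonzero-* R isField xi≉0 (nonzero-* R isField ya≉0 zb≉0)
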